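{- Let $n\ge 2$ and $a$ be integers such that $x^n-a$ is irreducible over $\mathbb{Q}$, let $\theta$ be a root of $x^n-a$ and $K=\mathbb{Q}(\theta)$. Let $p$ be a prime dividing $n$ and let $s\ge 1$ be the exponent of the highest power of $p$ dividing $n$. Assume that $p\nmid a$ and that the integer $r=v_p(a^{p-1}-1)-1$ is positive. Let $k$ be an integer with $1\le k\le \min\{r,s\}$, let $b'$ be an integer with $ab'\equiv 1 \pmod{p^{k+1}}$, and put $a'=(b')^{p^{s-k-1}}$ if $k<s$ and $a'=b'$ if $k=s$. Let $n'=n/p^k$ and $$\eta_k=\sum_{j=0}^{p^k-1}\left(a'\theta^{n'}\right)^j\in K.$$ Then $\eta_k/p^k$ is an algebraic integer.
   Context: $v_p(x)$ denotes the exponent of the highest power of the prime $p$ dividing the nonzero integer $x$. -}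

module Defs where

open import Data.Nat as ℕ using (ℕ; zero; suc; _<ᵇ_; _∸_)
open import Data.Integer as ℤ using (ℤ; +_)
open import Data.Rational as ℚ using (ℚ; 0ℚ; 1ℚ)
open import Data.List using (List; []; _∷_; _++_; replicate; map; upTo; foldr; [_])
open import Data.Bool using (if_then_else_)
open import Data.Product using (_×_; ∃)
open import Relation.Nullary using (¬_)
open import Relation.Binary.PropositionalEquality using (_≡_; _≢_)
import Data.Nat.Divisibility as ℕD
import Data.Integer.Divisibility as ℤD

-- Polynomials over ℚ: coefficient lists, lowest degree first.
Poly : Set
Poly = List ℚ

coeff : Poly → ℕ → ℚ
coeff []       _       = 0ℚ
coeff (c ∷ f)  zero    = c
coeff (c ∷ f)  (suc i) = coeff f i

-- equality of polynomials (coefficientwise, ignoring trailing zeros)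
_≈ₚ_ : Poly → Poly → Set
f ≈ₚ g = ∀ i → coeff f i ≡ coeff g i

infixl 6 _+ₚ_
infixl 7 _*ₚ_

_+ₚ_ : Poly → Poly → Poly
[]      +ₚ g       = g
(a ∷ f) +ₚ []      = a ∷ f
(a ∷ f) +ₚ (b ∷ g) = (a ℚ.+ b) ∷ (f +ₚ g)

scaleₚ : ℚ → Poly → Poly
scaleₚ c f = map (c ℚ.*_) f

_*ₚ_ : Poly → Poly → Poly
[]      *ₚ g = []
(a ∷ f) *ₚ g = scaleₚ a g +ₚ (0ℚ ∷ (f *ₚ g))

constₚ : ℚ → Poly
constₚ c = [ c ]

xpow : ℕ → Poly
xpow m = replicate m 0ℚ ++ [ 1ℚ ]

powₚ : Poly → ℕ → Poly
powₚ f zero    = [ 1ℚ ]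
powₚ f (suc m) = f *ₚ powₚ f m

sumₚ : List Poly → Poly
sumₚ = foldr _+ₚ_ []

ℤtoℚ : ℤ → ℚ
ℤtoℚ z = z ℚ./ 1

-- 1/m for m ≥ 1 (only used with m = p^k ≠ 0)
invℕ : ℕ → ℚ
invℕ zero    = 0ℚ
invℕ (suc m) = + 1 ℚ./ suc m

binomial : ℕ → ℤ → Poly
binomial n a = xpow n +ₚ constₚ (ℚ.- ℤtoℚ a)

Nonconstant : Poly → Set
Nonconstant f = ∃ λ i → coeff f (suc i) ≢ 0ℚ

-- irreducibility over ℚ of a nonconstant polynomial: not a product of two
-- non-units (the non-units of ℚ[x] being 0 and the nonconstant polynomials;
-- a factorisation with a zero factor is impossible since f ≠ 0)
IrreducibleQ : Poly → Set
IrreducibleQ f = Nonconstant f × ¬ (∃ λ g → ∃ λ h → Nonconstant g × Nonconstant h × (g *ₚ h) ≈ₚ f)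

_∣ₚ_ : Poly → Poly → Set
d ∣ₚ f = ∃ λ q → (q *ₚ d) ≈ₚ f

-- Elements of K = ℚ(θ) ≅ ℚ[x]/(x^n - a) are represented by polynomials g,
-- standing for g(θ).
evalℤ : List ℤ → Poly → Poly
evalℤ []       y = []
evalℤ (c ∷ cs) y = constₚ (ℤtoℚ c) +ₚ (y *ₚ evalℤ cs y)

-- g(θ) is an algebraic integer: it is a root of a monic polynomial with
-- integer coefficients  y^d + c_{d-1} y^{d-1} + ... + c_0  (cs = c_0 … c_{d-1}),
-- i.e. that polynomial evaluated at g is 0 in ℚ[x]/(x^n - a).
IsAlgIntegerIn : ℕ → ℤ → Poly → Set
IsAlgIntegerIn n a g = ∃ λ (cs : List ℤ) → binomial n a ∣ₚ evalℤ (cs ++ [ + 1 ]) g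

ValEq : ℕ → ℤ → ℕ → Set
ValEq p x e = (+ (p ℕ.^ e)) ℤD.∣ x × ¬ ((+ (p ℕ.^ suc e)) ℤD.∣ x)

ValEqℕ : ℕ → ℕ → ℕ → Set
ValEqℕ p x e = (p ℕ.^ e) ℕD.∣ x × ¬ ((p ℕ.^ suc e) ℕD.∣ x)

a′ : ℤ → ℕ → ℕ → ℕ → ℤ
a′ b p s k = if k <ᵇ s then b ℤ.^ (p ℕ.^ (s ∸ k ∸ 1)) else b

η : ℤ → ℕ → ℕ → Poly
η a' n' pk = sumₚ (map (powₚ (scaleₚ (ℤtoℚ a') (xpow n'))) (upTo pk))

-- Put q = p^k, γ = a'θ^n' and y = η_k/q, the mean of 1, γ, ..., γ^(q-1). Since θ^n = a,
-- γ^q = a'^q a =: c, and the hypotheses on a, b' and r give c ≡ 1 (mod p^(k+1)) but c ≠ 1,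
-- so c = 1 + q d with d = p z, z ≠ 0. The geometric sum (γ - 1) η_k = γ^q - 1 = q d says
-- γ y = y + d, hence (y + d)^q = c y^q. Expanding, y is a root of
-- Y^q - Σ_{j<q} C(q,j) d^(q-j) Y^j / (q d), whose coefficients are integers because
-- p^k divides C(p^k, j) p^(p^k-j-1). Everything is computed in ℚ[x]/(x^n - a).

module Submission where

open import Defs
open import Level using (0ℓ)
open import Function using (_∘_)
open import Data.Bool using (true; false)
open import Data.Maybe as Maybe using (Maybe; just; nothing)
open import Data.Empty using (⊥-elim)
open import Data.Sum using (_⊎_; inj₁; inj₂)
open import Data.Product using (∃; _×_; _,_; proj₁; proj₂)
open import Data.List using (List; []; _∷_; _++_; [_]; map; applyUpTo; upTo; length)
open import Data.List.Properties using (applyUpTo-∷ʳ; length-applyUpTo; map-upTo)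
open import Data.Nat as ℕ using (ℕ; zero; suc; _+_; _*_; _^_; _∸_; _≤_; _<_; z≤n; s≤s; nonTrivial⇒n>1)
import Data.Nat.Properties as ℕP
open import Data.Nat.Combinatorics using (_C_; nCn≡1; nC1≡n; k>n⇒nCk≡0; nCk≡nC[n∸k]; nCk+nC[k+1]≡[n+1]C[k+1])
open import Data.Nat.Divisibility using (_∣_; divides; 1∣_; _∣0; ∣-trans; ∣⇒≤; m∣m*n; *-monoʳ-∣; *-monoˡ-∣; *-cancelˡ-∣)
open import Data.Nat.Primality using (Prime; euclidsLemma; prime⇒nonZero; prime⇒nonTrivial)
open import Data.Integer as ℤ using (ℤ; +_; -[1+_])
import Data.Integer.Properties as ℤP
import Data.Integer.Divisibility as ℤD
import Data.Integer.Divisibility.Signed as ℤS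
open import Data.Rational as ℚ using (ℚ; 0ℚ; 1ℚ; mkℚ)
import Data.Rational.Properties as ℚP
import Data.Nat.Coprimality as Coprime
open import Relation.Nullary using (¬_; yes; no)
open import Relation.Binary.PropositionalEquality using (_≡_; _≢_; refl; sym; trans; cong; cong₂; subst; module ≡-Reasoning)
open import Algebra.Bundles using (CommutativeRing)
import Tactic.RingSolver.Core.AlmostCommutativeRing as ACR
import Tactic.RingSolver.NonReflective as RingSolver
open import Data.Rational.Solver renaming (module +-*-Solver to ℚ-Solver)
open import Data.Integer.Solver renaming (module +-*-Solver to ℤ-Solver)
open import Data.Nat.Solver renaming (module +-*-Solver to ℕ-Solver)

ℤtoℚ≡mkℚ : ∀ z → ℤtoℚ z ≡ mkℚ z 0 (Coprime.sym (Coprime.1-coprimeTo ℤ.∣ z ∣))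
ℤtoℚ≡mkℚ z = ℚP.↥p/↧p≡p _

↥ℤtoℚ : ∀ z → ℚ.↥ ℤtoℚ z ≡ z
↥ℤtoℚ z = cong ℚ.↥_ (ℤtoℚ≡mkℚ z)

ℤtoℚ-+ : ∀ x y → ℤtoℚ (x ℤ.+ y) ≡ ℤtoℚ x ℚ.+ ℤtoℚ y
ℤtoℚ-+ x y rewrite ℤtoℚ≡mkℚ x | ℤtoℚ≡mkℚ y =
  cong (ℚ._/ 1) (sym (cong₂ ℤ._+_ (ℤP.*-identityʳ x) (ℤP.*-identityʳ y)))

ℤtoℚ-* : ∀ x y → ℤtoℚ (x ℤ.* y) ≡ ℤtoℚ x ℚ.* ℤtoℚ y
ℤtoℚ-* x y rewrite ℤtoℚ≡mkℚ x | ℤtoℚ≡mkℚ y = refl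

ℤtoℚ-≢0 : ∀ {z} → z ≢ + 0 → ℤtoℚ z ≢ 0ℚ
ℤtoℚ-≢0 {z} z≢0 eq = z≢0 (trans (sym (↥ℤtoℚ z)) (cong ℚ.↥_ eq))

invℕ-inverseˡ : ∀ q .{{_ : ℕ.NonZero q}} → invℕ q ℚ.* ℤtoℚ (+ q) ≡ 1ℚ
invℕ-inverseˡ (suc m)
  rewrite ℚP.↥p/↧p≡p (mkℚ (+ 1) m (Coprime.1-coprimeTo (suc m))) | ℤtoℚ≡mkℚ (+ suc m)
  = ℚP.*-inverseˡ (mkℚ (+ suc m) 0 (Coprime.sym (Coprime.1-coprimeTo (suc m))))

-- Polynomial arithmetic over ℚ

Seq : Set
Seq = ℕ → ℚ

infix 4 _≐_
_≐_ : Seq → Seq → Set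
F ≐ G = ∀ i → F i ≡ G i

conv : Seq → Seq → Seq
conv F G zero    = F 0 ℚ.* G 0
conv F G (suc i) = F 0 ℚ.* G (suc i) ℚ.+ conv (F ∘ suc) G i

conv-zeroˡ : ∀ F G → F ≐ (λ _ → 0ℚ) → conv F G ≐ (λ _ → 0ℚ)
conv-zeroˡ F G F≐0 zero rewrite F≐0 0 = ℚP.*-zeroˡ (G 0)
conv-zeroˡ F G F≐0 (suc i)
  rewrite F≐0 0 | conv-zeroˡ (F ∘ suc) G (F≐0 ∘ suc) i | ℚP.*-zeroˡ (G (suc i)) = ℚP.+-identityˡ 0ℚ

conv-cong : ∀ {F F′ G G′} → F ≐ F′ → G ≐ G′ → conv F G ≐ conv F′ G′
conv-cong F≐ G≐ zero    = cong₂ ℚ._*_ (F≐ 0) (G≐ 0)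
conv-cong F≐ G≐ (suc i) = cong₂ ℚ._+_ (cong₂ ℚ._*_ (F≐ 0) (G≐ (suc i))) (conv-cong (F≐ ∘ suc) G≐ i)

conv-distribʳ : ∀ F F′ G → conv (λ j → F j ℚ.+ F′ j) G ≐ (λ i → conv F G i ℚ.+ conv F′ G i)
conv-distribʳ F F′ G zero    = ℚP.*-distribʳ-+ (G 0) (F 0) (F′ 0)
conv-distribʳ F F′ G (suc i) rewrite conv-distribʳ (F ∘ suc) (F′ ∘ suc) G i =
  solve 5 (λ a b g x y → (a :+ b) :* g :+ (x :+ y) := (a :* g :+ x) :+ (b :* g :+ y)) refl
    (F 0) (F′ 0) (G (suc i)) (conv (F ∘ suc) G i) (conv (F′ ∘ suc) G i)
  where
  open ℚ-Solver

conv-scaleˡ : ∀ c F G → conv (λ j → c ℚ.* F j) G ≐ (λ i → c ℚ.* conv F G i)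
conv-scaleˡ c F G zero    = ℚP.*-assoc c (F 0) (G 0)
conv-scaleˡ c F G (suc i) rewrite conv-scaleˡ c (F ∘ suc) G i =
  solve 4 (λ c a g x → c :* a :* g :+ c :* x := c :* (a :* g :+ x)) refl c (F 0) (G (suc i)) (conv (F ∘ suc) G i)
  where
  open ℚ-Solver

conv-sucʳ : ∀ F G i → conv F G (suc i) ≡ conv F (G ∘ suc) i ℚ.+ F (suc i) ℚ.* G 0
conv-sucʳ F G zero    = refl
conv-sucʳ F G (suc i) rewrite conv-sucʳ (F ∘ suc) G i = sym (ℚP.+-assoc (F 0 ℚ.* G (suc (suc i))) _ _)

conv-comm : ∀ F G → conv F G ≐ conv G F
conv-comm F G zero    = ℚP.*-comm (F 0) (G 0)
conv-comm F G (suc i)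
  rewrite conv-sucʳ G F i | conv-comm (F ∘ suc) G i | ℚP.*-comm (G (suc i)) (F 0) =
  ℚP.+-comm (F 0 ℚ.* G (suc i)) (conv G (F ∘ suc) i)

conv-assoc : ∀ F G H → conv (conv F G) H ≐ conv F (conv G H)
conv-assoc F G H zero    = ℚP.*-assoc (F 0) (G 0) (H 0)
conv-assoc F G H (suc i) = begin
    conv F G 0 ℚ.* H (suc i) ℚ.+ conv (conv F G ∘ suc) H i
  ≡⟨ cong (conv F G 0 ℚ.* H (suc i) ℚ.+_) (conv-distribʳ (λ j → F 0 ℚ.* G (suc j)) (conv (F ∘ suc) G) H i) ⟩
    conv F G 0 ℚ.* H (suc i) ℚ.+ (conv (λ j → F 0 ℚ.* G (suc j)) H i ℚ.+ conv (conv (F ∘ suc) G) H i)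
  ≡⟨ cong₂ (λ u v → conv F G 0 ℚ.* H (suc i) ℚ.+ (u ℚ.+ v))
       (conv-scaleˡ (F 0) (G ∘ suc) H i) (conv-assoc (F ∘ suc) G H i) ⟩
    F 0 ℚ.* G 0 ℚ.* H (suc i) ℚ.+ (F 0 ℚ.* conv (G ∘ suc) H i ℚ.+ conv (F ∘ suc) (conv G H) i)
  ≡⟨ solve 5 (λ f g h x y → f :* g :* h :+ (f :* x :+ y) := f :* (g :* h :+ x) :+ y) refl
       (F 0) (G 0) (H (suc i)) (conv (G ∘ suc) H i) (conv (F ∘ suc) (conv G H) i) ⟩
    F 0 ℚ.* conv G H (suc i) ℚ.+ conv (F ∘ suc) (conv G H) i
  ∎
  where
  open ≡-Reasoning
  open ℚ-Solver

δ : ℚ → Seq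
δ c zero    = c
δ c (suc _) = 0ℚ

conv-δˡ : ∀ c G → conv (δ c) G ≐ (λ i → c ℚ.* G i)
conv-δˡ c G zero    = refl
conv-δˡ c G (suc i) rewrite conv-zeroˡ (δ c ∘ suc) G (λ _ → refl) i = ℚP.+-identityʳ _

coeff-+ₚ : ∀ f g i → coeff (f +ₚ g) i ≡ coeff f i ℚ.+ coeff g i
coeff-+ₚ []      g       i       = sym (ℚP.+-identityˡ _)
coeff-+ₚ (a ∷ f) []      i       = sym (ℚP.+-identityʳ _)
coeff-+ₚ (a ∷ f) (b ∷ g) zero    = refl
coeff-+ₚ (a ∷ f) (b ∷ g) (suc i) = coeff-+ₚ f g i

coeff-scaleₚ : ∀ c f i → coeff (scaleₚ c f) i ≡ c ℚ.* coeff f i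
coeff-scaleₚ c []      i       = sym (ℚP.*-zeroʳ c)
coeff-scaleₚ c (a ∷ f) zero    = refl
coeff-scaleₚ c (a ∷ f) (suc i) = coeff-scaleₚ c f i

coeff-*ₚ : ∀ f g → coeff (f *ₚ g) ≐ conv (coeff f) (coeff g)
coeff-*ₚ []      g i       = sym (conv-zeroˡ (coeff []) (coeff g) (λ _ → refl) i)
coeff-*ₚ (a ∷ f) g zero    =
  trans (coeff-+ₚ (scaleₚ a g) (0ℚ ∷ (f *ₚ g)) 0) (trans (ℚP.+-identityʳ _) (coeff-scaleₚ a g 0))
coeff-*ₚ (a ∷ f) g (suc i) =
  trans (coeff-+ₚ (scaleₚ a g) (0ℚ ∷ (f *ₚ g)) (suc i)) (cong₂ ℚ._+_ (coeff-scaleₚ a g (suc i)) (coeff-*ₚ f g i))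

coeff-constₚ : ∀ c → coeff (constₚ c) ≐ δ c
coeff-constₚ c zero    = refl
coeff-constₚ c (suc i) = refl

-- Wrapping _≈ₚ_ in a record keeps both polynomials visible to unification.
infix 4 _≋_
record _≋_ (f g : Poly) : Set where
  constructor ⟪_⟫
  field coeff-≡ : f ≈ₚ g
open _≋_ public

-ₚ_ : Poly → Poly
-ₚ f = scaleₚ (ℚ.- 1ℚ) f

1ₚ : Poly
1ₚ = constₚ 1ℚ

≋-refl : ∀ {f} → f ≋ f
≋-refl = ⟪ (λ _ → refl) ⟫

≋-sym : ∀ {f g} → f ≋ g → g ≋ f
≋-sym f≋g = ⟪ (λ i → sym (coeff-≡ f≋g i)) ⟫

≋-trans : ∀ {f g h} → f ≋ g → g ≋ h → f ≋ h
≋-trans f≋g g≋h = ⟪ (λ i → trans (coeff-≡ f≋g i) (coeff-≡ g≋h i)) ⟫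

≡⇒≋ : ∀ {f g} → f ≡ g → f ≋ g
≡⇒≋ refl = ≋-refl

+ₚ-cong : ∀ {f f′ g g′} → f ≋ f′ → g ≋ g′ → f +ₚ g ≋ f′ +ₚ g′
+ₚ-cong {f} {f′} {g} {g′} f≋ g≋ =
  ⟪ (λ i → trans (coeff-+ₚ f g i) (trans (cong₂ ℚ._+_ (coeff-≡ f≋ i) (coeff-≡ g≋ i)) (sym (coeff-+ₚ f′ g′ i)))) ⟫

*ₚ-cong : ∀ {f f′ g g′} → f ≋ f′ → g ≋ g′ → f *ₚ g ≋ f′ *ₚ g′
*ₚ-cong {f} {f′} {g} {g′} f≋ g≋ =
  ⟪ (λ i → trans (coeff-*ₚ f g i) (trans (conv-cong (coeff-≡ f≋) (coeff-≡ g≋) i) (sym (coeff-*ₚ f′ g′ i)))) ⟫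

scaleₚ-cong : ∀ c {f g} → f ≋ g → scaleₚ c f ≋ scaleₚ c g
scaleₚ-cong c {f} {g} f≋g =
  ⟪ (λ i → trans (coeff-scaleₚ c f i) (trans (cong (c ℚ.*_) (coeff-≡ f≋g i)) (sym (coeff-scaleₚ c g i)))) ⟫

+ₚ-comm : ∀ f g → f +ₚ g ≋ g +ₚ f
+ₚ-comm f g = ⟪ (λ i → trans (coeff-+ₚ f g i) (trans (ℚP.+-comm (coeff f i) (coeff g i)) (sym (coeff-+ₚ g f i)))) ⟫

+ₚ-assoc : ∀ f g h → (f +ₚ g) +ₚ h ≋ f +ₚ (g +ₚ h)
+ₚ-assoc f g h = ⟪ (λ i → begin
    coeff ((f +ₚ g) +ₚ h) i                   ≡⟨ coeff-+ₚ (f +ₚ g) h i ⟩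
    coeff (f +ₚ g) i ℚ.+ coeff h i            ≡⟨ cong (ℚ._+ coeff h i) (coeff-+ₚ f g i) ⟩
    (coeff f i ℚ.+ coeff g i) ℚ.+ coeff h i   ≡⟨ ℚP.+-assoc (coeff f i) (coeff g i) (coeff h i) ⟩
    coeff f i ℚ.+ (coeff g i ℚ.+ coeff h i)   ≡⟨ cong (coeff f i ℚ.+_) (coeff-+ₚ g h i) ⟨
    coeff f i ℚ.+ coeff (g +ₚ h) i            ≡⟨ coeff-+ₚ f (g +ₚ h) i ⟨
    coeff (f +ₚ (g +ₚ h)) i                   ∎) ⟫
  where
  open ≡-Reasoning

+ₚ-identityˡ : ∀ f → [] +ₚ f ≋ f
+ₚ-identityˡ f = ≋-refl

+ₚ-identityʳ : ∀ f → f +ₚ [] ≋ f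
+ₚ-identityʳ f = ⟪ (λ i → trans (coeff-+ₚ f [] i) (ℚP.+-identityʳ _)) ⟫

-ₚ-inverseˡ : ∀ f → (-ₚ f) +ₚ f ≋ []
-ₚ-inverseˡ f = ⟪ (λ i → trans (coeff-+ₚ (-ₚ f) f i) (trans (cong (ℚ._+ coeff f i) (coeff-scaleₚ (ℚ.- 1ℚ) f i))
  (solve 1 (λ c → (:- con 1ℚ) :* c :+ c := con 0ℚ) refl (coeff f i)))) ⟫
  where
  open ℚ-Solver

-ₚ-inverseʳ : ∀ f → f +ₚ (-ₚ f) ≋ []
-ₚ-inverseʳ f = ≋-trans (+ₚ-comm f (-ₚ f)) (-ₚ-inverseˡ f)

*ₚ-comm : ∀ f g → f *ₚ g ≋ g *ₚ f
*ₚ-comm f g = ⟪ (λ i → trans (coeff-*ₚ f g i) (trans (conv-comm (coeff f) (coeff g) i) (sym (coeff-*ₚ g f i)))) ⟫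

*ₚ-assoc : ∀ f g h → (f *ₚ g) *ₚ h ≋ f *ₚ (g *ₚ h)
*ₚ-assoc f g h = ⟪ (λ i → begin
    coeff ((f *ₚ g) *ₚ h) i                       ≡⟨ coeff-*ₚ (f *ₚ g) h i ⟩
    conv (coeff (f *ₚ g)) (coeff h) i             ≡⟨ conv-cong (coeff-*ₚ f g) (λ _ → refl) i ⟩
    conv (conv (coeff f) (coeff g)) (coeff h) i   ≡⟨ conv-assoc (coeff f) (coeff g) (coeff h) i ⟩
    conv (coeff f) (conv (coeff g) (coeff h)) i   ≡⟨ conv-cong {coeff f} (λ _ → refl) (coeff-*ₚ g h) i ⟨
    conv (coeff f) (coeff (g *ₚ h)) i             ≡⟨ coeff-*ₚ f (g *ₚ h) i ⟨
    coeff (f *ₚ (g *ₚ h)) i                       ∎) ⟫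
  where
  open ≡-Reasoning

constₚ-*ₚ : ∀ c f → constₚ c *ₚ f ≋ scaleₚ c f
constₚ-*ₚ c f = ⟪ (λ i → trans (coeff-*ₚ (constₚ c) f i)
  (trans (conv-cong (coeff-constₚ c) (λ _ → refl) i) (trans (conv-δˡ c (coeff f) i) (sym (coeff-scaleₚ c f i))))) ⟫

*ₚ-identityˡ : ∀ f → 1ₚ *ₚ f ≋ f
*ₚ-identityˡ f = ≋-trans (constₚ-*ₚ 1ℚ f) ⟪ (λ i → trans (coeff-scaleₚ 1ℚ f i) (ℚP.*-identityˡ _)) ⟫

*ₚ-identityʳ : ∀ f → f *ₚ 1ₚ ≋ f
*ₚ-identityʳ f = ≋-trans (*ₚ-comm f 1ₚ) (*ₚ-identityˡ f)

*ₚ-distribʳ : ∀ h f g → (f +ₚ g) *ₚ h ≋ f *ₚ h +ₚ g *ₚ h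
*ₚ-distribʳ h f g = ⟪ (λ i → begin
    coeff ((f +ₚ g) *ₚ h) i                                         ≡⟨ coeff-*ₚ (f +ₚ g) h i ⟩
    conv (coeff (f +ₚ g)) (coeff h) i                               ≡⟨ conv-cong (coeff-+ₚ f g) (λ _ → refl) i ⟩
    conv (λ j → coeff f j ℚ.+ coeff g j) (coeff h) i                ≡⟨ conv-distribʳ (coeff f) (coeff g) (coeff h) i ⟩
    conv (coeff f) (coeff h) i ℚ.+ conv (coeff g) (coeff h) i       ≡⟨ cong₂ ℚ._+_ (coeff-*ₚ f h i) (coeff-*ₚ g h i) ⟨
    coeff (f *ₚ h) i ℚ.+ coeff (g *ₚ h) i                           ≡⟨ coeff-+ₚ (f *ₚ h) (g *ₚ h) i ⟨
    coeff (f *ₚ h +ₚ g *ₚ h) i                                      ∎) ⟫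
  where
  open ≡-Reasoning

*ₚ-distribˡ : ∀ h f g → h *ₚ (f +ₚ g) ≋ h *ₚ f +ₚ h *ₚ g
*ₚ-distribˡ h f g =
  ≋-trans (*ₚ-comm h (f +ₚ g)) (≋-trans (*ₚ-distribʳ h f g) (+ₚ-cong (*ₚ-comm f h) (*ₚ-comm g h)))

ℚ[x] : CommutativeRing 0ℓ 0ℓ
ℚ[x] = record
  { Carrier = Poly ; _≈_ = _≋_ ; _+_ = _+ₚ_ ; _*_ = _*ₚ_ ; -_ = -ₚ_ ; 0# = [] ; 1# = 1ₚ
  ; isCommutativeRing = record
    { isRing = record
      { +-isAbelianGroup = record
        { isGroup = record
          { isMonoid = record
            { isSemigroup = record
              { isMagma = record
                { isEquivalence = record { refl = ≋-refl ; sym = ≋-sym ; trans = ≋-trans }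
                ; ∙-cong = +ₚ-cong }
              ; assoc = +ₚ-assoc }
            ; identity = +ₚ-identityˡ , +ₚ-identityʳ }
          ; inverse = -ₚ-inverseˡ , -ₚ-inverseʳ
          ; ⁻¹-cong = scaleₚ-cong (ℚ.- 1ℚ) }
        ; comm = +ₚ-comm }
      ; *-cong = *ₚ-cong
      ; *-assoc = *ₚ-assoc
      ; *-identity = *ₚ-identityˡ , *ₚ-identityʳ
      ; distrib = *ₚ-distribˡ , *ₚ-distribʳ }
    ; *-comm = *ₚ-comm } }

X*ₚ≋0∷ : ∀ g → xpow 1 *ₚ g ≋ 0ℚ ∷ g
X*ₚ≋0∷ g = ⟪ (λ i → trans (coeff-+ₚ (scaleₚ 0ℚ g) (0ℚ ∷ (1ₚ *ₚ g)) i)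
  (trans (cong₂ ℚ._+_ (trans (coeff-scaleₚ 0ℚ g i) (ℚP.*-zeroˡ (coeff g i))) (shift i)) (ℚP.+-identityˡ _))) ⟫
  where
  shift : ∀ i → coeff (0ℚ ∷ (1ₚ *ₚ g)) i ≡ coeff (0ℚ ∷ g) i
  shift zero    = refl
  shift (suc i) = coeff-≡ (*ₚ-identityˡ g) i

isZeroₚ : ∀ g → Maybe ([] ≋ g)
isZeroₚ []      = just ≋-refl
isZeroₚ (c ∷ g) with c ℚ.≟ 0ℚ | isZeroₚ g
... | yes c≡0 | just []≋g = just ⟪ (λ { zero → sym c≡0 ; (suc i) → coeff-≡ []≋g i }) ⟫
... | _       | _         = nothing

module ℚ[x]-Solver = RingSolver (ACR.fromCommutativeRing ℚ[x] isZeroₚ)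

-- The quotient ring ℚ[x]/(f) and integrality

fromℤ : ℤ → Poly
fromℤ z = constₚ (ℤtoℚ z)

meanOfPowers : Poly → ℕ → Poly
meanOfPowers γ q = scaleₚ (invℕ q) (sumₚ (map (powₚ γ) (upTo q)))

applyUpTo-cong : ∀ {A : Set} {g h : ℕ → A} n → (∀ j → j < n → g j ≡ h j) → applyUpTo g n ≡ applyUpTo h n
applyUpTo-cong zero    g≡h = refl
applyUpTo-cong (suc n) g≡h = cong₂ _∷_ (g≡h 0 (s≤s z≤n)) (applyUpTo-cong n (λ j j<n → g≡h (suc j) (s≤s j<n)))

binomialCoeff : ℤ → ℕ → ℕ → ℤ
binomialCoeff d m j = + (m C j) ℤ.* d ℤ.^ (m ∸ j)

binomialCoeff-zero : ∀ d m → binomialCoeff d (suc m) 0 ≡ d ℤ.* binomialCoeff d m 0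
binomialCoeff-zero d m = trans (ℤP.*-identityˡ _) (cong (d ℤ.*_) (sym (ℤP.*-identityˡ _)))

binomialCoeff-diagonal : ∀ d m → binomialCoeff d m m ≡ + 1
binomialCoeff-diagonal d m rewrite nCn≡1 m | ℕP.n∸n≡0 m = refl

binomialCoeff-above : ∀ d m j → m < j → binomialCoeff d m j ≡ + 0
binomialCoeff-above d m j m<j rewrite k>n⇒nCk≡0 m<j = ℤP.*-zeroˡ (d ℤ.^ (m ∸ j))

binomialCoeff-suc : ∀ d m j → binomialCoeff d (suc m) (suc j) ≡ binomialCoeff d m j ℤ.+ d ℤ.* binomialCoeff d m (suc j)
binomialCoeff-suc d m j = begin
    + (suc m C suc j) ℤ.* d ℤ.^ (m ∸ j)
  ≡⟨ cong (λ c → + c ℤ.* d ℤ.^ (m ∸ j)) (nCk+nC[k+1]≡[n+1]C[k+1] m j) ⟨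
    + (m C j + m C suc j) ℤ.* d ℤ.^ (m ∸ j)
  ≡⟨ trans (cong (ℤ._* d ℤ.^ (m ∸ j)) (ℤP.pos-+ (m C j) (m C suc j))) (ℤP.*-distribʳ-+ (d ℤ.^ (m ∸ j)) (+ (m C j)) (+ (m C suc j))) ⟩
    binomialCoeff d m j ℤ.+ + (m C suc j) ℤ.* d ℤ.^ (m ∸ j)
  ≡⟨ cong (ℤ._+_ (binomialCoeff d m j)) shift ⟩
    binomialCoeff d m j ℤ.+ d ℤ.* binomialCoeff d m (suc j)
  ∎
  where
  open ≡-Reasoning
  shift : + (m C suc j) ℤ.* d ℤ.^ (m ∸ j) ≡ d ℤ.* binomialCoeff d m (suc j)
  shift with j ℕ.<? m
  ... | yes j<m rewrite ℕP.+-∸-assoc 1 j<m =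
    solve 3 (λ c d x → c :* (d :* x) := d :* (c :* x)) refl (+ (m C suc j)) d (d ℤ.^ (m ∸ suc j))
    where
    open ℤ-Solver
  ... | no j≮m rewrite k>n⇒nCk≡0 (s≤s (ℕP.≮⇒≥ j≮m))
    = trans (ℤP.*-zeroˡ (d ℤ.^ (m ∸ j))) (sym (trans (cong (d ℤ.*_) (ℤP.*-zeroˡ (d ℤ.^ (m ∸ suc j)))) (ℤP.*-zeroʳ d)))

module Modulo (f : Poly) where

  infix 4 _≈ₘ_
  record _≈ₘ_ (g h : Poly) : Set where
    constructor _by_
    field
      quotient : Poly
      equation : quotient *ₚ f +ₚ h ≋ g

  ≋⇒≈ₘ : ∀ {g h} → g ≋ h → g ≈ₘ h
  ≋⇒≈ₘ g≋h = [] by ≋-sym g≋h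

  ≈ₘ-refl : ∀ {g} → g ≈ₘ g
  ≈ₘ-refl = ≋⇒≈ₘ ≋-refl

  ≈ₘ-sym : ∀ {g h} → g ≈ₘ h → h ≈ₘ g
  ≈ₘ-sym {g} {h} (t by e) = (-ₚ t) by (begin
      (-ₚ t) *ₚ f +ₚ g             ≈⟨ +ₚ-cong ≋-refl (≋-sym e) ⟩
      (-ₚ t) *ₚ f +ₚ (t *ₚ f +ₚ h) ≈⟨ solve 3 (λ t f h → ((⊝ t) ⊗ f ⊕ (t ⊗ f ⊕ h)) ⊜ h) ≋-refl t f h ⟩
      h                            ∎)
    where
    open ℚ[x]-Solver
    open import Relation.Binary.Reasoning.Setoid (CommutativeRing.setoid ℚ[x])

  ≈ₘ-trans : ∀ {g h k} → g ≈ₘ h → h ≈ₘ k → g ≈ₘ k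
  ≈ₘ-trans {g} {h} {k} (t by e) (t′ by e′) = (t +ₚ t′) by (begin
      (t +ₚ t′) *ₚ f +ₚ k        ≈⟨ solve 4 (λ t t′ f k → ((t ⊕ t′) ⊗ f ⊕ k) ⊜ (t ⊗ f ⊕ (t′ ⊗ f ⊕ k))) ≋-refl t t′ f k ⟩
      t *ₚ f +ₚ (t′ *ₚ f +ₚ k)   ≈⟨ +ₚ-cong ≋-refl e′ ⟩
      t *ₚ f +ₚ h                ≈⟨ e ⟩
      g                          ∎)
    where
    open ℚ[x]-Solver
    open import Relation.Binary.Reasoning.Setoid (CommutativeRing.setoid ℚ[x])

  +ₚ-cong-≈ₘ : ∀ {g g′ h h′} → g ≈ₘ g′ → h ≈ₘ h′ → g +ₚ h ≈ₘ g′ +ₚ h′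
  +ₚ-cong-≈ₘ {g} {g′} {h} {h′} (t by e) (t′ by e′) = (t +ₚ t′) by (begin
      (t +ₚ t′) *ₚ f +ₚ (g′ +ₚ h′)
    ≈⟨ solve 5 (λ t t′ f g h → ((t ⊕ t′) ⊗ f ⊕ (g ⊕ h)) ⊜ ((t ⊗ f ⊕ g) ⊕ (t′ ⊗ f ⊕ h))) ≋-refl t t′ f g′ h′ ⟩
      (t *ₚ f +ₚ g′) +ₚ (t′ *ₚ f +ₚ h′)
    ≈⟨ +ₚ-cong e e′ ⟩
      g +ₚ h
    ∎)
    where
    open ℚ[x]-Solver
    open import Relation.Binary.Reasoning.Setoid (CommutativeRing.setoid ℚ[x])

  *ₚ-cong-≈ₘ : ∀ {g g′ h h′} → g ≈ₘ g′ → h ≈ₘ h′ → g *ₚ h ≈ₘ g′ *ₚ h′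
  *ₚ-cong-≈ₘ {g} {g′} {h} {h′} (t by e) (t′ by e′) = (t *ₚ h +ₚ g′ *ₚ t′) by (begin
      (t *ₚ h +ₚ g′ *ₚ t′) *ₚ f +ₚ g′ *ₚ h′
    ≈⟨ solve 6 (λ t h g t′ f h′ → ((t ⊗ h ⊕ g ⊗ t′) ⊗ f ⊕ g ⊗ h′) ⊜ ((t ⊗ f ⊕ g) ⊗ h ⊕ g ⊗ ((t′ ⊗ f ⊕ h′) ⊕ (⊝ h))))
         ≋-refl t h g′ t′ f h′ ⟩
      (t *ₚ f +ₚ g′) *ₚ h +ₚ g′ *ₚ ((t′ *ₚ f +ₚ h′) +ₚ (-ₚ h))
    ≈⟨ +ₚ-cong (*ₚ-cong e ≋-refl) (*ₚ-cong (≋-refl {g′}) (≋-trans (+ₚ-cong e′ ≋-refl) (-ₚ-inverseʳ h))) ⟩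
      g *ₚ h +ₚ g′ *ₚ []
    ≈⟨ solve 2 (λ x g → (x ⊕ g ⊗ Κ []) ⊜ x) ≋-refl (g *ₚ h) g′ ⟩
      g *ₚ h
    ∎)
    where
    open ℚ[x]-Solver
    open import Relation.Binary.Reasoning.Setoid (CommutativeRing.setoid ℚ[x])

  -ₚ-cong-≈ₘ : ∀ {g g′} → g ≈ₘ g′ → (-ₚ g) ≈ₘ (-ₚ g′)
  -ₚ-cong-≈ₘ {g} {g′} (t by e) = (-ₚ t) by (begin
      (-ₚ t) *ₚ f +ₚ (-ₚ g′)  ≈⟨ solve 3 (λ t f g → ((⊝ t) ⊗ f ⊕ (⊝ g)) ⊜ (⊝ (t ⊗ f ⊕ g))) ≋-refl t f g′ ⟩
      -ₚ (t *ₚ f +ₚ g′)       ≈⟨ scaleₚ-cong (ℚ.- 1ℚ) e ⟩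
      -ₚ g                    ∎)
    where
    open ℚ[x]-Solver
    open import Relation.Binary.Reasoning.Setoid (CommutativeRing.setoid ℚ[x])

  ℚ[x]/⟨f⟩ : CommutativeRing 0ℓ 0ℓ
  ℚ[x]/⟨f⟩ = record
    { Carrier = Poly ; _≈_ = _≈ₘ_ ; _+_ = _+ₚ_ ; _*_ = _*ₚ_ ; -_ = -ₚ_ ; 0# = [] ; 1# = 1ₚ
    ; isCommutativeRing = record
      { isRing = record
        { +-isAbelianGroup = record
          { isGroup = record
            { isMonoid = record
              { isSemigroup = record
                { isMagma = record
                  { isEquivalence = record { refl = ≈ₘ-refl ; sym = ≈ₘ-sym ; trans = ≈ₘ-trans }
                  ; ∙-cong = +ₚ-cong-≈ₘ }
                ; assoc = λ g h k → ≋⇒≈ₘ (+ₚ-assoc g h k) }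
              ; identity = (λ g → ≋⇒≈ₘ (+ₚ-identityˡ g)) , (λ g → ≋⇒≈ₘ (+ₚ-identityʳ g)) }
            ; inverse = (λ g → ≋⇒≈ₘ (-ₚ-inverseˡ g)) , (λ g → ≋⇒≈ₘ (-ₚ-inverseʳ g))
            ; ⁻¹-cong = -ₚ-cong-≈ₘ }
          ; comm = λ g h → ≋⇒≈ₘ (+ₚ-comm g h) }
        ; *-cong = *ₚ-cong-≈ₘ
        ; *-assoc = λ g h k → ≋⇒≈ₘ (*ₚ-assoc g h k)
        ; *-identity = (λ g → ≋⇒≈ₘ (*ₚ-identityˡ g)) , (λ g → ≋⇒≈ₘ (*ₚ-identityʳ g))
        ; distrib = (λ g h k → ≋⇒≈ₘ (*ₚ-distribˡ g h k)) , (λ g h k → ≋⇒≈ₘ (*ₚ-distribʳ g h k)) }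
      ; *-comm = λ g h → ≋⇒≈ₘ (*ₚ-comm g h) } }

  isZeroₘ : ∀ g → Maybe ([] ≈ₘ g)
  isZeroₘ g = Maybe.map ≋⇒≈ₘ (isZeroₚ g)

  open RingSolver (ACR.fromCommutativeRing ℚ[x]/⟨f⟩ isZeroₘ) using (solve; _⊕_; _⊗_; _⊜_; ⊝_; Κ)
  open CommutativeRing ℚ[x]/⟨f⟩ using (setoid; semiring; commutativeSemiring; +-cong; +-congˡ; +-congʳ; *-cong; *-congˡ; *-congʳ)
  open import Relation.Binary.Reasoning.Setoid setoid
  open import Algebra.Properties.Semiring.Exp semiring public using () renaming (_^_ to _^ₘ_)
  open import Algebra.Properties.Semiring.Exp semiring using (^-congˡ)
  open import Algebra.Properties.CommutativeSemiring.Exp commutativeSemiring using (^-distrib-*)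

  fromℤ-+ : ∀ x y → fromℤ (x ℤ.+ y) ≈ₘ fromℤ x +ₚ fromℤ y
  fromℤ-+ x y = ≋⇒≈ₘ (≡⇒≋ (cong constₚ (ℤtoℚ-+ x y)))

  fromℤ-* : ∀ x y → fromℤ (x ℤ.* y) ≈ₘ fromℤ x *ₚ fromℤ y
  fromℤ-* x y = ≋⇒≈ₘ (≋-trans (≡⇒≋ (cong constₚ (ℤtoℚ-* x y))) (≋-sym (constₚ-*ₚ (ℤtoℚ x) (fromℤ y))))

  fromℤ-^ : ∀ z m → fromℤ (z ℤ.^ m) ≈ₘ fromℤ z ^ₘ m
  fromℤ-^ z zero    = ≈ₘ-refl
  fromℤ-^ z (suc m) = ≈ₘ-trans (fromℤ-* z (z ℤ.^ m)) (*-congˡ {fromℤ z} (fromℤ-^ z m))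

  fromℤ-cancelˡ : ∀ {D g} → D ≢ + 0 → fromℤ D *ₚ g ≈ₘ [] → g ≈ₘ []
  fromℤ-cancelˡ {D} {g} D≢0 Dg≈0 = begin
      g                                  ≈⟨ solve 1 (λ g → g ⊜ (Κ 1ₚ ⊗ g)) ≈ₘ-refl g ⟩
      1ₚ *ₚ g                            ≈⟨ *-congʳ {g} (≋⇒≈ₘ (≋-sym D⁻¹D≋1)) ⟩
      (D⁻¹ *ₚ fromℤ D) *ₚ g              ≈⟨ solve 3 (λ a b g → ((a ⊗ b) ⊗ g) ⊜ (a ⊗ (b ⊗ g))) ≈ₘ-refl D⁻¹ (fromℤ D) g ⟩
      D⁻¹ *ₚ (fromℤ D *ₚ g)              ≈⟨ *-congˡ {D⁻¹} Dg≈0 ⟩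
      D⁻¹ *ₚ []                          ≈⟨ solve 1 (λ a → (a ⊗ Κ []) ⊜ Κ []) ≈ₘ-refl D⁻¹ ⟩
      []                                 ∎
    where
    instance _ = ℚ.≢-nonZero (ℤtoℚ-≢0 D≢0)
    D⁻¹ = constₚ (ℚ.1/ ℤtoℚ D)
    D⁻¹D≋1 : D⁻¹ *ₚ fromℤ D ≋ 1ₚ
    D⁻¹D≋1 = ≋-trans (constₚ-*ₚ (ℚ.1/ ℤtoℚ D) (fromℤ D)) (≡⇒≋ (cong constₚ (ℚP.*-inverseˡ (ℤtoℚ D))))

  evalℤ-++ : ∀ L M y → evalℤ (L ++ M) y ≈ₘ evalℤ L y +ₚ y ^ₘ length L *ₚ evalℤ M y
  evalℤ-++ []      M y = solve 1 (λ e → e ⊜ (Κ [] ⊕ Κ 1ₚ ⊗ e)) ≈ₘ-refl (evalℤ M y)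
  evalℤ-++ (c ∷ L) M y = begin
      fromℤ c +ₚ y *ₚ evalℤ (L ++ M) y
    ≈⟨ +-congˡ {fromℤ c} (*-congˡ {y} (evalℤ-++ L M y)) ⟩
      fromℤ c +ₚ y *ₚ (evalℤ L y +ₚ y ^ₘ length L *ₚ evalℤ M y)
    ≈⟨ solve 5 (λ c y e p m → (c ⊕ y ⊗ (e ⊕ p ⊗ m)) ⊜ ((c ⊕ y ⊗ e) ⊕ (y ⊗ p) ⊗ m)) ≈ₘ-refl
         (fromℤ c) y (evalℤ L y) (y ^ₘ length L) (evalℤ M y) ⟩
      (fromℤ c +ₚ y *ₚ evalℤ L y) +ₚ y ^ₘ suc (length L) *ₚ evalℤ M y
    ∎

  evalℤ-applyUpTo-suc : ∀ g n y → evalℤ (applyUpTo g (suc n)) y ≈ₘ evalℤ (applyUpTo g n) y +ₚ y ^ₘ n *ₚ fromℤ (g n)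
  evalℤ-applyUpTo-suc g n y = begin
      evalℤ (applyUpTo g (suc n)) y
    ≡⟨ cong (λ L → evalℤ L y) (applyUpTo-∷ʳ g n) ⟨
      evalℤ (applyUpTo g n ++ [ g n ]) y
    ≈⟨ evalℤ-++ (applyUpTo g n) [ g n ] y ⟩
      evalℤ (applyUpTo g n) y +ₚ y ^ₘ length (applyUpTo g n) *ₚ (fromℤ (g n) +ₚ y *ₚ [])
    ≡⟨ cong (λ k → evalℤ (applyUpTo g n) y +ₚ y ^ₘ k *ₚ (fromℤ (g n) +ₚ y *ₚ [])) (length-applyUpTo g n) ⟩
      evalℤ (applyUpTo g n) y +ₚ y ^ₘ n *ₚ (fromℤ (g n) +ₚ y *ₚ [])
    ≈⟨ solve 4 (λ e p c y → (e ⊕ p ⊗ (c ⊕ y ⊗ Κ [])) ⊜ (e ⊕ p ⊗ c)) ≈ₘ-refl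
         (evalℤ (applyUpTo g n) y) (y ^ₘ n) (fromℤ (g n)) y ⟩
      evalℤ (applyUpTo g n) y +ₚ y ^ₘ n *ₚ fromℤ (g n)
    ∎

  evalℤ-applyUpTo-+ : ∀ g h n y →
    evalℤ (applyUpTo (λ j → g j ℤ.+ h j) n) y ≈ₘ evalℤ (applyUpTo g n) y +ₚ evalℤ (applyUpTo h n) y
  evalℤ-applyUpTo-+ g h zero    y = ≈ₘ-refl
  evalℤ-applyUpTo-+ g h (suc n) y = begin
      fromℤ (g 0 ℤ.+ h 0) +ₚ y *ₚ evalℤ (applyUpTo (λ j → g (suc j) ℤ.+ h (suc j)) n) y
    ≈⟨ +-cong (fromℤ-+ (g 0) (h 0)) (*-congˡ {y} (evalℤ-applyUpTo-+ (g ∘ suc) (h ∘ suc) n y)) ⟩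
      (fromℤ (g 0) +ₚ fromℤ (h 0)) +ₚ y *ₚ (evalℤ (applyUpTo (g ∘ suc) n) y +ₚ evalℤ (applyUpTo (h ∘ suc) n) y)
    ≈⟨ solve 5 (λ a b y u v → ((a ⊕ b) ⊕ y ⊗ (u ⊕ v)) ⊜ ((a ⊕ y ⊗ u) ⊕ (b ⊕ y ⊗ v))) ≈ₘ-refl
         (fromℤ (g 0)) (fromℤ (h 0)) y (evalℤ (applyUpTo (g ∘ suc) n) y) (evalℤ (applyUpTo (h ∘ suc) n) y) ⟩
      evalℤ (applyUpTo g (suc n)) y +ₚ evalℤ (applyUpTo h (suc n)) y
    ∎

  evalℤ-applyUpTo-* : ∀ c g n y → evalℤ (applyUpTo (λ j → c ℤ.* g j) n) y ≈ₘ fromℤ c *ₚ evalℤ (applyUpTo g n) y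
  evalℤ-applyUpTo-* c g zero    y = solve 1 (λ c → Κ [] ⊜ (c ⊗ Κ [])) ≈ₘ-refl (fromℤ c)
  evalℤ-applyUpTo-* c g (suc n) y = begin
      fromℤ (c ℤ.* g 0) +ₚ y *ₚ evalℤ (applyUpTo (λ j → c ℤ.* g (suc j)) n) y
    ≈⟨ +-cong (fromℤ-* c (g 0)) (*-congˡ {y} (evalℤ-applyUpTo-* c (g ∘ suc) n y)) ⟩
      fromℤ c *ₚ fromℤ (g 0) +ₚ y *ₚ (fromℤ c *ₚ evalℤ (applyUpTo (g ∘ suc) n) y)
    ≈⟨ solve 4 (λ c a y s → (c ⊗ a ⊕ y ⊗ (c ⊗ s)) ⊜ (c ⊗ (a ⊕ y ⊗ s))) ≈ₘ-refl
         (fromℤ c) (fromℤ (g 0)) y (evalℤ (applyUpTo (g ∘ suc) n) y) ⟩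
      fromℤ c *ₚ evalℤ (applyUpTo g (suc n)) y
    ∎

  binomial-expansion : ∀ d m y → (y +ₚ fromℤ d) ^ₘ m ≈ₘ evalℤ (applyUpTo (binomialCoeff d m) (suc m)) y
  binomial-expansion d zero    y = solve 1 (λ y → Κ 1ₚ ⊜ (Κ 1ₚ ⊕ y ⊗ Κ [])) ≈ₘ-refl y
  binomial-expansion d (suc m) y = begin
      (y +ₚ fromℤ d) *ₚ (y +ₚ fromℤ d) ^ₘ m
    ≈⟨ *-congˡ {y +ₚ fromℤ d} (binomial-expansion d m y) ⟩
      (y +ₚ fromℤ d) *ₚ (fromℤ (c 0) +ₚ y *ₚ S)
    ≈⟨ solve 4 (λ y d a s → ((y ⊕ d) ⊗ (a ⊕ y ⊗ s)) ⊜ (d ⊗ a ⊕ y ⊗ ((a ⊕ y ⊗ s) ⊕ d ⊗ s))) ≈ₘ-refl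
         y (fromℤ d) (fromℤ (c 0)) S ⟩
      fromℤ d *ₚ fromℤ (c 0) +ₚ y *ₚ (evalℤ (applyUpTo c (suc m)) y +ₚ fromℤ d *ₚ S)
    ≈⟨ +-congˡ {fromℤ d *ₚ fromℤ (c 0)} (*-congˡ {y} (+-congˡ {evalℤ (applyUpTo c (suc m)) y}
         (*-congˡ {fromℤ d} (≈ₘ-sym top-vanishes)))) ⟩
      fromℤ d *ₚ fromℤ (c 0) +ₚ y *ₚ (evalℤ (applyUpTo c (suc m)) y +ₚ fromℤ d *ₚ evalℤ (applyUpTo (c ∘ suc) (suc m)) y)
    ≈⟨ +-cong (≈ₘ-sym (fromℤ-* d (c 0))) (*-congˡ {y} (≈ₘ-sym
         (≈ₘ-trans (evalℤ-applyUpTo-+ c (λ j → d ℤ.* c (suc j)) (suc m) y)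
                   (+-congˡ {evalℤ (applyUpTo c (suc m)) y} (evalℤ-applyUpTo-* d (c ∘ suc) (suc m) y))))) ⟩
      fromℤ (d ℤ.* c 0) +ₚ y *ₚ evalℤ (applyUpTo (λ j → c j ℤ.+ d ℤ.* c (suc j)) (suc m)) y
    ≡⟨ cong₂ (λ u L → fromℤ u +ₚ y *ₚ evalℤ L y)
         (sym (binomialCoeff-zero d m)) (applyUpTo-cong (suc m) (λ j _ → sym (binomialCoeff-suc d m j))) ⟩
      evalℤ (applyUpTo (binomialCoeff d (suc m)) (suc (suc m))) y
    ∎
    where
    c = binomialCoeff d m
    S = evalℤ (applyUpTo (c ∘ suc) m) y
    top-vanishes : evalℤ (applyUpTo (c ∘ suc) (suc m)) y ≈ₘ S
    top-vanishes = begin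
        evalℤ (applyUpTo (c ∘ suc) (suc m)) y  ≈⟨ evalℤ-applyUpTo-suc (c ∘ suc) m y ⟩
        S +ₚ y ^ₘ m *ₚ fromℤ (c (suc m))       ≡⟨ cong (λ z → S +ₚ y ^ₘ m *ₚ fromℤ z) (binomialCoeff-above d m (suc m) ℕP.≤-refl) ⟩
        S +ₚ y ^ₘ m *ₚ fromℤ (+ 0)             ≈⟨ solve 2 (λ s p → (s ⊕ p ⊗ Κ (fromℤ (+ 0))) ⊜ s) ≈ₘ-refl S (y ^ₘ m) ⟩
        S                                      ∎

  IsIntegral : Poly → Set
  IsIntegral y = ∃ λ (cs : List ℤ) → evalℤ (cs ++ [ + 1 ]) y ≈ₘ []

  binomial-relation⇒isIntegral : ∀ {y d D} q → D ≢ + 0 → (∀ j → j < q → D ℤS.∣ binomialCoeff d q j)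
    → (y +ₚ fromℤ d) ^ₘ q ≈ₘ (1ₚ +ₚ fromℤ D) *ₚ y ^ₘ q → IsIntegral y
  binomial-relation⇒isIntegral {y} {d} {D} q D≢0 D∣coeff relation = applyUpTo (ℤ.-_ ∘ E) q , fromℤ-cancelˡ D≢0 (begin
      fromℤ D *ₚ evalℤ (applyUpTo (ℤ.-_ ∘ E) q ++ [ + 1 ]) y
    ≈⟨ *-congˡ {fromℤ D} (evalℤ-++ (applyUpTo (ℤ.-_ ∘ E) q) [ + 1 ] y) ⟩
      fromℤ D *ₚ (A +ₚ y ^ₘ length (applyUpTo (ℤ.-_ ∘ E) q) *ₚ (1ₚ +ₚ y *ₚ []))
    ≡⟨ cong (λ k → fromℤ D *ₚ (A +ₚ y ^ₘ k *ₚ (1ₚ +ₚ y *ₚ []))) (length-applyUpTo (ℤ.-_ ∘ E) q) ⟩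
      fromℤ D *ₚ (A +ₚ P *ₚ (1ₚ +ₚ y *ₚ []))
    ≈⟨ solve 4 (λ d a p y → (d ⊗ (a ⊕ p ⊗ (Κ 1ₚ ⊕ y ⊗ Κ []))) ⊜ (d ⊗ a ⊕ d ⊗ p)) ≈ₘ-refl (fromℤ D) A P y ⟩
      fromℤ D *ₚ A +ₚ fromℤ D *ₚ P
    ≈⟨ +-congʳ {fromℤ D *ₚ P} DA≈-S ⟩
      (-ₚ S) +ₚ fromℤ D *ₚ P
    ≈⟨ +-congʳ {fromℤ D *ₚ P} (-ₚ-cong-≈ₘ S≈DP) ⟩
      (-ₚ (fromℤ D *ₚ P)) +ₚ fromℤ D *ₚ P
    ≈⟨ solve 1 (λ x → ((⊝ x) ⊕ x) ⊜ Κ []) ≈ₘ-refl (fromℤ D *ₚ P) ⟩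
      []
    ∎)
    where
    E : ℕ → ℤ
    E j with j ℕ.<? q
    ... | yes j<q = ℤS.quotient (D∣coeff j j<q)
    ... | no _    = + 0
    DE≡-coeff : ∀ j → j < q → D ℤ.* (ℤ.- E j) ≡ ℤ.- + 1 ℤ.* binomialCoeff d q j
    DE≡-coeff j j<q with j ℕ.<? q
    ... | no j≮q  = ⊥-elim (j≮q j<q)
    ... | yes j<q′ = trans (sym (ℤP.neg-distribʳ-* D quotient))
      (trans (cong ℤ.-_ (trans (ℤP.*-comm D quotient) (sym equality))) (sym (ℤP.-1*i≡-i _)))
      where
      open ℤS._∣_ (D∣coeff j j<q′)
    A = evalℤ (applyUpTo (ℤ.-_ ∘ E) q) y
    S = evalℤ (applyUpTo (binomialCoeff d q) q) y
    P = y ^ₘ q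
    DA≈-S : fromℤ D *ₚ A ≈ₘ -ₚ S
    DA≈-S = begin
        fromℤ D *ₚ A
      ≈⟨ ≈ₘ-sym (evalℤ-applyUpTo-* D (ℤ.-_ ∘ E) q y) ⟩
        evalℤ (applyUpTo (λ j → D ℤ.* (ℤ.- E j)) q) y
      ≡⟨ cong (λ L → evalℤ L y) (applyUpTo-cong q DE≡-coeff) ⟩
        evalℤ (applyUpTo (λ j → ℤ.- + 1 ℤ.* binomialCoeff d q j) q) y
      ≈⟨ evalℤ-applyUpTo-* (ℤ.- + 1) (binomialCoeff d q) q y ⟩
        (-ₚ 1ₚ) *ₚ S
      ≈⟨ solve 1 (λ s → ((⊝ Κ 1ₚ) ⊗ s) ⊜ (⊝ s)) ≈ₘ-refl S ⟩
        -ₚ S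
      ∎
    S≈DP : S ≈ₘ fromℤ D *ₚ P
    S≈DP = begin
        S
      ≈⟨ solve 2 (λ s p → s ⊜ ((s ⊕ p ⊗ Κ 1ₚ) ⊕ (⊝ p))) ≈ₘ-refl S P ⟩
        (S +ₚ P *ₚ 1ₚ) +ₚ (-ₚ P)
      ≡⟨ cong (λ z → (S +ₚ P *ₚ fromℤ z) +ₚ (-ₚ P)) (binomialCoeff-diagonal d q) ⟨
        (S +ₚ P *ₚ fromℤ (binomialCoeff d q q)) +ₚ (-ₚ P)
      ≈⟨ +-congʳ { -ₚ P} (≈ₘ-sym (evalℤ-applyUpTo-suc (binomialCoeff d q) q y)) ⟩
        evalℤ (applyUpTo (binomialCoeff d q) (suc q)) y +ₚ (-ₚ P)
      ≈⟨ +-congʳ { -ₚ P} (≈ₘ-trans (≈ₘ-sym (binomial-expansion d q y)) relation) ⟩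
        (1ₚ +ₚ fromℤ D) *ₚ P +ₚ (-ₚ P)
      ≈⟨ solve 2 (λ d p → ((Κ 1ₚ ⊕ d) ⊗ p ⊕ (⊝ p)) ⊜ (d ⊗ p)) ≈ₘ-refl (fromℤ D) P ⟩
        fromℤ D *ₚ P
      ∎

  powₚ≡^ₘ : ∀ g m → powₚ g m ≡ g ^ₘ m
  powₚ≡^ₘ g zero    = refl
  powₚ≡^ₘ g (suc m) = cong (g *ₚ_) (powₚ≡^ₘ g m)

  scaleₚ≈constₚ-*ₚ : ∀ c g → scaleₚ c g ≈ₘ constₚ c *ₚ g
  scaleₚ≈constₚ-*ₚ c g = ≋⇒≈ₘ (≋-sym (constₚ-*ₚ c g))

  geometric-sum : ∀ γ x (u : ℕ → Poly) q → (∀ j → u j ≈ₘ x *ₚ γ ^ₘ j)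
    → (γ +ₚ (-ₚ 1ₚ)) *ₚ sumₚ (applyUpTo u q) ≈ₘ x *ₚ γ ^ₘ q +ₚ (-ₚ x)
  geometric-sum γ x u zero    u≈ = solve 2 (λ g x → ((g ⊕ (⊝ Κ 1ₚ)) ⊗ Κ []) ⊜ (x ⊗ Κ 1ₚ ⊕ (⊝ x))) ≈ₘ-refl γ x
  geometric-sum γ x u (suc q) u≈ = begin
      (γ +ₚ (-ₚ 1ₚ)) *ₚ (u 0 +ₚ Σ)
    ≈⟨ *-congˡ {γ +ₚ (-ₚ 1ₚ)} (+-congʳ {Σ} (u≈ 0)) ⟩
      (γ +ₚ (-ₚ 1ₚ)) *ₚ (x *ₚ 1ₚ +ₚ Σ)
    ≈⟨ solve 3 (λ g x s → ((g ⊕ (⊝ Κ 1ₚ)) ⊗ (x ⊗ Κ 1ₚ ⊕ s)) ⊜ ((g ⊕ (⊝ Κ 1ₚ)) ⊗ x ⊕ (g ⊕ (⊝ Κ 1ₚ)) ⊗ s)) ≈ₘ-refl γ x Σ ⟩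
      (γ +ₚ (-ₚ 1ₚ)) *ₚ x +ₚ (γ +ₚ (-ₚ 1ₚ)) *ₚ Σ
    ≈⟨ +-congˡ {(γ +ₚ (-ₚ 1ₚ)) *ₚ x} (geometric-sum γ (x *ₚ γ) (u ∘ suc) q (λ j → ≈ₘ-trans (u≈ (suc j))
         (solve 3 (λ x g p → (x ⊗ (g ⊗ p)) ⊜ ((x ⊗ g) ⊗ p)) ≈ₘ-refl x γ (γ ^ₘ j)))) ⟩
      (γ +ₚ (-ₚ 1ₚ)) *ₚ x +ₚ (x *ₚ γ *ₚ γ ^ₘ q +ₚ (-ₚ (x *ₚ γ)))
    ≈⟨ solve 3 (λ g x p → ((g ⊕ (⊝ Κ 1ₚ)) ⊗ x ⊕ (x ⊗ g ⊗ p ⊕ (⊝ (x ⊗ g)))) ⊜ (x ⊗ (g ⊗ p) ⊕ (⊝ x))) ≈ₘ-refl γ x (γ ^ₘ q) ⟩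
      x *ₚ γ ^ₘ suc q +ₚ (-ₚ x)
    ∎
    where Σ = sumₚ (applyUpTo (u ∘ suc) q)

  meanOfPowers-shift : ∀ γ d q .{{_ : ℕ.NonZero q}} → γ ^ₘ q ≈ₘ 1ₚ +ₚ fromℤ (+ q ℤ.* d)
    → γ *ₚ meanOfPowers γ q ≈ₘ meanOfPowers γ q +ₚ fromℤ d
  meanOfPowers-shift γ d q γ^q≈ = begin
      γ *ₚ y
    ≈⟨ *-congˡ {γ} y≈ιΣ ⟩
      γ *ₚ (ι *ₚ Σ)
    ≈⟨ solve 3 (λ g i e → (g ⊗ (i ⊗ e)) ⊜ (i ⊗ ((g ⊕ (⊝ Κ 1ₚ)) ⊗ e) ⊕ i ⊗ e)) ≈ₘ-refl γ ι Σ ⟩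
      ι *ₚ ((γ +ₚ (-ₚ 1ₚ)) *ₚ Σ) +ₚ ι *ₚ Σ
    ≈⟨ +-cong (*-congˡ {ι} [γ-1]Σ≈qd) (≈ₘ-sym y≈ιΣ) ⟩
      ι *ₚ (fromℤ (+ q) *ₚ fromℤ d) +ₚ y
    ≈⟨ +-congʳ {y} (≈ₘ-trans (solve 3 (λ i k d → (i ⊗ (k ⊗ d)) ⊜ ((i ⊗ k) ⊗ d)) ≈ₘ-refl ι (fromℤ (+ q)) (fromℤ d))
         (*-congʳ {fromℤ d} ιq≈1)) ⟩
      1ₚ *ₚ fromℤ d +ₚ y
    ≈⟨ solve 2 (λ d y → (Κ 1ₚ ⊗ d ⊕ y) ⊜ (y ⊕ d)) ≈ₘ-refl (fromℤ d) y ⟩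
      y +ₚ fromℤ d
    ∎
    where
    ι = constₚ (invℕ q)
    Σ = sumₚ (map (powₚ γ) (upTo q))
    y = meanOfPowers γ q
    y≈ιΣ : y ≈ₘ ι *ₚ Σ
    y≈ιΣ = scaleₚ≈constₚ-*ₚ (invℕ q) Σ
    ιq≈1 : ι *ₚ fromℤ (+ q) ≈ₘ 1ₚ
    ιq≈1 = ≋⇒≈ₘ (≋-trans (constₚ-*ₚ (invℕ q) (fromℤ (+ q))) (≡⇒≋ (cong constₚ (invℕ-inverseˡ q))))
    [γ-1]Σ≈qd : (γ +ₚ (-ₚ 1ₚ)) *ₚ Σ ≈ₘ fromℤ (+ q) *ₚ fromℤ d
    [γ-1]Σ≈qd = begin
        (γ +ₚ (-ₚ 1ₚ)) *ₚ Σ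
      ≡⟨ cong (λ L → (γ +ₚ (-ₚ 1ₚ)) *ₚ sumₚ L) (map-upTo (powₚ γ) q) ⟩
        (γ +ₚ (-ₚ 1ₚ)) *ₚ sumₚ (applyUpTo (powₚ γ) q)
      ≈⟨ geometric-sum γ 1ₚ (powₚ γ) q (λ j → ≈ₘ-trans (≋⇒≈ₘ (≡⇒≋ (powₚ≡^ₘ γ j)))
           (solve 1 (λ p → p ⊜ (Κ 1ₚ ⊗ p)) ≈ₘ-refl (γ ^ₘ j))) ⟩
        1ₚ *ₚ γ ^ₘ q +ₚ (-ₚ 1ₚ)
      ≈⟨ +-congʳ { -ₚ 1ₚ} (*-congˡ {1ₚ} (≈ₘ-trans γ^q≈ (+-congˡ {1ₚ} (fromℤ-* (+ q) d)))) ⟩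
        1ₚ *ₚ (1ₚ +ₚ fromℤ (+ q) *ₚ fromℤ d) +ₚ (-ₚ 1ₚ)
      ≈⟨ solve 2 (λ k d → (Κ 1ₚ ⊗ (Κ 1ₚ ⊕ k ⊗ d) ⊕ (⊝ Κ 1ₚ)) ⊜ (k ⊗ d)) ≈ₘ-refl (fromℤ (+ q)) (fromℤ d) ⟩
        fromℤ (+ q) *ₚ fromℤ d
      ∎

  meanOfPowers-isIntegral : ∀ γ d q .{{_ : ℕ.NonZero q}} → + q ℤ.* d ≢ + 0
    → (∀ j → j < q → (+ q ℤ.* d) ℤS.∣ binomialCoeff d q j)
    → γ ^ₘ q ≈ₘ 1ₚ +ₚ fromℤ (+ q ℤ.* d) → IsIntegral (meanOfPowers γ q)
  meanOfPowers-isIntegral γ d q D≢0 D∣coeff γ^q≈ = binomial-relation⇒isIntegral q D≢0 D∣coeff (begin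
      (y +ₚ fromℤ d) ^ₘ q   ≈⟨ ^-congˡ q (≈ₘ-sym (meanOfPowers-shift γ d q γ^q≈)) ⟩
      (γ *ₚ y) ^ₘ q         ≈⟨ ^-distrib-* γ y q ⟩
      γ ^ₘ q *ₚ y ^ₘ q      ≈⟨ *-congʳ {y ^ₘ q} γ^q≈ ⟩
      (1ₚ +ₚ fromℤ (+ q ℤ.* d)) *ₚ y ^ₘ q ∎)
    where y = meanOfPowers γ q

  xpow≈X^ₘ : ∀ m → xpow m ≈ₘ xpow 1 ^ₘ m
  xpow≈X^ₘ zero    = ≈ₘ-refl
  xpow≈X^ₘ (suc m) = ≈ₘ-trans (≋⇒≈ₘ (≋-sym (X*ₚ≋0∷ (xpow m)))) (*-congˡ {xpow 1} (xpow≈X^ₘ m))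

module RadicalExtension (n : ℕ) (a : ℤ) where
  open Modulo (binomial n a)
  open CommutativeRing ℚ[x]/⟨f⟩ using (setoid; *-congˡ; *-congʳ; *-cong)
  open import Relation.Binary.Reasoning.Setoid setoid
  open import Algebra.Properties.Semiring.Exp (CommutativeRing.semiring ℚ[x]/⟨f⟩) using (^-congˡ; ^-assocʳ)
  open import Algebra.Properties.CommutativeSemiring.Exp (CommutativeRing.commutativeSemiring ℚ[x]/⟨f⟩) using (^-distrib-*)

  θ^n≈a : xpow n ≈ₘ fromℤ a
  θ^n≈a = 1ₚ by ≋-trans (+ₚ-cong (*ₚ-identityˡ (binomial n a)) ≋-refl)
    (≋-trans (+ₚ-assoc (xpow n) (constₚ (ℚ.- ℤtoℚ a)) (fromℤ a))
    (≋-trans (+ₚ-cong (≋-refl {xpow n}) ⟪ (λ { zero → ℚP.+-inverseˡ (ℤtoℚ a) ; (suc i) → refl }) ⟫) (+ₚ-identityʳ (xpow n))))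

  monomial-^ : ∀ c n′ q → n ≡ n′ * q → scaleₚ (ℤtoℚ c) (xpow n′) ^ₘ q ≈ₘ fromℤ (c ℤ.^ q ℤ.* a)
  monomial-^ c n′ q n≡n′q = begin
      scaleₚ (ℤtoℚ c) (xpow n′) ^ₘ q
    ≈⟨ ^-congˡ q (≈ₘ-trans (scaleₚ≈constₚ-*ₚ (ℤtoℚ c) (xpow n′)) (*-congˡ {fromℤ c} (xpow≈X^ₘ n′))) ⟩
      (fromℤ c *ₚ xpow 1 ^ₘ n′) ^ₘ q
    ≈⟨ ^-distrib-* (fromℤ c) (xpow 1 ^ₘ n′) q ⟩
      fromℤ c ^ₘ q *ₚ (xpow 1 ^ₘ n′) ^ₘ q
    ≈⟨ *-cong (≈ₘ-sym (fromℤ-^ c q)) (^-assocʳ (xpow 1) n′ q) ⟩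
      fromℤ (c ℤ.^ q) *ₚ xpow 1 ^ₘ (n′ * q)
    ≡⟨ cong (λ m → fromℤ (c ℤ.^ q) *ₚ xpow 1 ^ₘ m) n≡n′q ⟨
      fromℤ (c ℤ.^ q) *ₚ xpow 1 ^ₘ n
    ≈⟨ *-congˡ {fromℤ (c ℤ.^ q)} (≈ₘ-trans (≈ₘ-sym (xpow≈X^ₘ n)) θ^n≈a) ⟩
      fromℤ (c ℤ.^ q) *ₚ fromℤ a
    ≈⟨ ≈ₘ-sym (fromℤ-* (c ℤ.^ q) a) ⟩
      fromℤ (c ℤ.^ q ℤ.* a)
    ∎

  isIntegral⇒isAlgInteger : ∀ {g} → IsIntegral g → IsAlgIntegerIn n a g
  isIntegral⇒isAlgInteger (cs , (t by e)) = cs , t , λ i → trans (sym (coeff-≡ (+ₚ-identityʳ (t *ₚ binomial n a)) i)) (coeff-≡ e i)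

-- Divisibility of binomial coefficients by p^k

[1+k]*[1+n]C[1+k]≡[1+n]*nCk : ∀ n k → suc k * (suc n C suc k) ≡ suc n * (n C k)
[1+k]*[1+n]C[1+k]≡[1+n]*nCk zero    zero    = refl
[1+k]*[1+n]C[1+k]≡[1+n]*nCk zero    (suc k)
  rewrite k>n⇒nCk≡0 {1} {suc (suc k)} (s≤s (s≤s z≤n)) | k>n⇒nCk≡0 {0} {suc k} (s≤s z≤n) = ℕP.*-zeroʳ (suc (suc k))
[1+k]*[1+n]C[1+k]≡[1+n]*nCk (suc n) zero    rewrite nC1≡n (suc (suc n)) = trans (ℕP.+-identityʳ _) (sym (ℕP.*-identityʳ _))
[1+k]*[1+n]C[1+k]≡[1+n]*nCk (suc n) (suc k) = begin
    suc (suc k) * (suc (suc n) C suc (suc k))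
  ≡⟨ cong (suc (suc k) *_) (nCk+nC[k+1]≡[n+1]C[k+1] (suc n) (suc k)) ⟨
    suc (suc k) * (suc n C suc k + suc n C suc (suc k))
  ≡⟨ solve 3 (λ k a b → (con 2 :+ k) :* (a :+ b) := a :+ (con 1 :+ k) :* a :+ (con 2 :+ k) :* b) refl
       k (suc n C suc k) (suc n C suc (suc k)) ⟩
    suc n C suc k + suc k * (suc n C suc k) + suc (suc k) * (suc n C suc (suc k))
  ≡⟨ cong₂ (λ u v → suc n C suc k + u + v) ([1+k]*[1+n]C[1+k]≡[1+n]*nCk n k) ([1+k]*[1+n]C[1+k]≡[1+n]*nCk n (suc k)) ⟩
    suc n C suc k + suc n * (n C k) + suc n * (n C suc k)
  ≡⟨ solve 4 (λ c n a b → c :+ (con 1 :+ n) :* a :+ (con 1 :+ n) :* b := c :+ (con 1 :+ n) :* (a :+ b)) refl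
       (suc n C suc k) n (n C k) (n C suc k) ⟩
    suc n C suc k + suc n * (n C k + n C suc k)
  ≡⟨ cong (λ z → suc n C suc k + suc n * z) (nCk+nC[k+1]≡[n+1]C[k+1] n k) ⟩
    suc n C suc k + suc n * (suc n C suc k)
  ∎
  where
  open ≡-Reasoning
  open ℕ-Solver

^-monoʳ-∣ : ∀ p {m n} → m ≤ n → p ^ m ∣ p ^ n
^-monoʳ-∣ p {m} {n} m≤n = divides (p ^ (n ∸ m))
  (trans (cong (p ^_) (sym (ℕP.m+[n∸m]≡n m≤n))) (trans (ℕP.^-distribˡ-+-* p m (n ∸ m)) (ℕP.*-comm (p ^ m) _)))

-- Each factor p of p^k comes either from x or from 1 + m = (1 + m₁) p, and then 1 + m₁ ≤ m.
p^k∣[1+m]*x⇒p^k∣p^m*x : ∀ {p} → Prime p → ∀ k m x → p ^ k ∣ suc m * x → p ^ k ∣ p ^ m * x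
p^k∣[1+m]*x⇒p^k∣p^m*x         pp zero    m x _ = 1∣ _
p^k∣[1+m]*x⇒p^k∣p^m*x {p} pp (suc k) m x p^[1+k]∣
  with euclidsLemma (suc m) x pp (∣-trans (m∣m*n (p ^ k)) p^[1+k]∣)
... | inj₂ (divides x′ refl) =
  subst (p ^ suc k ∣_) (solve 3 (λ p a b → p :* (a :* b) := a :* (b :* p)) refl p (p ^ m) x′)
    (*-monoʳ-∣ p (p^k∣[1+m]*x⇒p^k∣p^m*x pp k m x′ (*-cancelˡ-∣ p
      (subst (p ^ suc k ∣_) (solve 3 (λ a b p → a :* (b :* p) := p :* (a :* b)) refl (suc m) x′ p) p^[1+k]∣))))
  where
  open ℕ-Solver
  instance _ = prime⇒nonZero pp
... | inj₁ (divides (suc m₁) 1+m≡[1+m₁]p) =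
  ∣-trans (subst (p ^ suc k ∣_) (sym (ℕP.*-assoc p (p ^ m₁) x))
            (*-monoʳ-∣ p (p^k∣[1+m]*x⇒p^k∣p^m*x pp k m₁ x (*-cancelˡ-∣ p (subst (p ^ suc k ∣_) [1+m]x≡p[1+m₁]x p^[1+k]∣)))))
          (*-monoˡ-∣ x (^-monoʳ-∣ p 1+m₁≤m))
  where
  instance _ = prime⇒nonZero pp
  instance _ = prime⇒nonTrivial pp
  [1+m]x≡p[1+m₁]x : suc m * x ≡ p * (suc m₁ * x)
  [1+m]x≡p[1+m₁]x = trans (cong (_* x) 1+m≡[1+m₁]p) (solve 3 (λ a p x → a :* p :* x := p :* (a :* x)) refl (suc m₁) p x)
    where
    open ℕ-Solver
  1+m₁≤m : suc m₁ ≤ m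
  1+m₁≤m = ℕP.≤-pred (subst (suc m₁ <_) (sym 1+m≡[1+m₁]p) (ℕP.m<m*n (suc m₁) p (nonTrivial⇒n>1 p)))

p^k∣[p^k]Cj*p^[p^k∸1+j] : ∀ {p} → Prime p → ∀ k j → j < p ^ k → p ^ k ∣ (p ^ k C j) * p ^ (p ^ k ∸ suc j)
p^k∣[p^k]Cj*p^[p^k∸1+j] {p} pp k j j<q = subst (q ∣_) (trans (ℕP.*-comm (p ^ r) _) (cong (_* p ^ r) (sym qCj≡qC[1+r])))
  (p^k∣[1+m]*x⇒p^k∣p^m*x pp k r (q C suc r) (subst (λ q → q ∣ suc r * (q C suc r)) (ℕP.suc-pred q)
    (divides (ℕ.pred q C r) (trans ([1+k]*[1+n]C[1+k]≡[1+n]*nCk (ℕ.pred q) r) (ℕP.*-comm (suc (ℕ.pred q)) _)))))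
  where
  instance _ = prime⇒nonZero pp
  instance _ = ℕP.m^n≢0 p k
  q = p ^ k
  r = q ∸ suc j
  qCj≡qC[1+r] : q C j ≡ q C suc r
  qCj≡qC[1+r] = trans (nCk≡nC[n∸k] (ℕP.<⇒≤ j<q)) (cong (q C_) (ℕP.+-∸-assoc 1 j<q))

-- The congruence a'^(p^k) a ≡ 1 (mod p^(k+1))

pos-^ : ∀ m n → + (m ^ n) ≡ (+ m) ℤ.^ n
pos-^ m zero    = refl
pos-^ m (suc n) = trans (ℤP.pos-* m (m ^ n)) (cong (ℤ._*_ (+ m)) (pos-^ m n))

^-distribʳ-* : ∀ x y n → (x ℤ.* y) ℤ.^ n ≡ x ℤ.^ n ℤ.* y ℤ.^ n
^-distribʳ-* x y zero    = refl
^-distribʳ-* x y (suc n) rewrite ^-distribʳ-* x y n =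
  solve 4 (λ x y a b → x :* y :* (a :* b) := x :* a :* (y :* b)) refl x y (x ℤ.^ n) (y ℤ.^ n)
  where
  open ℤ-Solver

[x-1]∣[x^n-1] : ∀ x n → (x ℤ.- + 1) ℤS.∣ (x ℤ.^ n ℤ.- + 1)
[x-1]∣[x^n-1] x zero    = ℤS.divides (+ 0) (ℤP.+-inverseʳ (+ 1))
[x-1]∣[x^n-1] x (suc n) with [x-1]∣[x^n-1] x n
... | ℤS.divides t x^n-1≡t[x-1] = ℤS.divides (x ℤ.* t ℤ.+ + 1) (begin
    x ℤ.* x ℤ.^ n ℤ.- + 1                         ≡⟨ solve 2 (λ x p → x :* p :- con (+ 1) := x :* (p :- con (+ 1)) :+ (x :- con (+ 1))) refl x (x ℤ.^ n) ⟩
    x ℤ.* (x ℤ.^ n ℤ.- + 1) ℤ.+ (x ℤ.- + 1)       ≡⟨ cong (λ z → x ℤ.* z ℤ.+ (x ℤ.- + 1)) x^n-1≡t[x-1] ⟩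
    x ℤ.* (t ℤ.* (x ℤ.- + 1)) ℤ.+ (x ℤ.- + 1)     ≡⟨ solve 2 (λ x t → x :* (t :* (x :- con (+ 1))) :+ (x :- con (+ 1)) := (x :* t :+ con (+ 1)) :* (x :- con (+ 1))) refl x t ⟩
    (x ℤ.* t ℤ.+ + 1) ℤ.* (x ℤ.- + 1)             ∎)
  where
  open ≡-Reasoning
  open ℤ-Solver

[1+x]^n≡1+x*h : ∀ x n → ∃ λ h → suc x ^ n ≡ suc (x * h)
[1+x]^n≡1+x*h x zero    = 0 , cong suc (sym (ℕP.*-zeroʳ x))
[1+x]^n≡1+x*h x (suc n) with [1+x]^n≡1+x*h x n
... | h , eq = suc x * h + 1 , trans (cong (suc x *_) eq)
  (solve 2 (λ x h → (con 1 :+ x) :* (con 1 :+ x :* h) := con 1 :+ x :* ((con 1 :+ x) :* h :+ con 1)) refl x h)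
  where
  open ℕ-Solver

b^[1+th]*a≡1 : ∀ {M} a b t h → M ℤS.∣ a ℤ.* b ℤ.- + 1 → M ℤS.∣ a ℤ.^ t ℤ.- + 1 → M ℤS.∣ b ℤ.^ suc (t * h) ℤ.* a ℤ.- + 1
b^[1+th]*a≡1 {M} a b t h M∣ab-1 M∣a^t-1 = subst (M ℤS.∣_) (sym split)
  (ℤS.∣m∣n⇒∣m-n (ℤS.∣-trans M∣ab-1 ([x-1]∣[x^n-1] (a ℤ.* b) N))
                (ℤS.∣n⇒∣m*n (b ℤ.^ N ℤ.* a) (ℤS.∣-trans M∣a^t-1 ([x-1]∣[x^n-1] (a ℤ.^ t) h))))
  where
  open ≡-Reasoning
  N = suc (t * h)
  [ab]^N≡b^Na[a^t]^h : (a ℤ.* b) ℤ.^ N ≡ b ℤ.^ N ℤ.* a ℤ.* (a ℤ.^ t) ℤ.^ h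
  [ab]^N≡b^Na[a^t]^h = begin
      (a ℤ.* b) ℤ.^ N                       ≡⟨ ^-distribʳ-* a b N ⟩
      a ℤ.* a ℤ.^ (t * h) ℤ.* b ℤ.^ N       ≡⟨ cong (λ z → a ℤ.* z ℤ.* b ℤ.^ N) (ℤP.^-*-assoc a t h) ⟨
      a ℤ.* (a ℤ.^ t) ℤ.^ h ℤ.* b ℤ.^ N     ≡⟨ solve 3 (λ a x y → a :* x :* y := y :* a :* x) refl a ((a ℤ.^ t) ℤ.^ h) (b ℤ.^ N) ⟩
      b ℤ.^ N ℤ.* a ℤ.* (a ℤ.^ t) ℤ.^ h     ∎
    where
    open ℤ-Solver
  split : b ℤ.^ N ℤ.* a ℤ.- + 1 ≡ ((a ℤ.* b) ℤ.^ N ℤ.- + 1) ℤ.- b ℤ.^ N ℤ.* a ℤ.* ((a ℤ.^ t) ℤ.^ h ℤ.- + 1)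
  split = trans (solve 2 (λ y x → y :- con (+ 1) := (y :* x :- con (+ 1)) :- y :* (x :- con (+ 1))) refl (b ℤ.^ N ℤ.* a) ((a ℤ.^ t) ℤ.^ h))
    (cong (λ w → (w ℤ.- + 1) ℤ.- b ℤ.^ N ℤ.* a ℤ.* ((a ℤ.^ t) ℤ.^ h ℤ.- + 1)) (sym [ab]^N≡b^Na[a^t]^h))
    where
    open ℤ-Solver

a′^p^k≡b′^p^u : ∀ b p s k → ∃ λ u → a′ b p s k ℤ.^ (p ^ k) ≡ b ℤ.^ (p ^ u)
a′^p^k≡b′^p^u b p s k with k ℕ.<ᵇ s
... | true  = s ∸ k ∸ 1 + k , trans (ℤP.^-*-assoc b (p ^ (s ∸ k ∸ 1)) (p ^ k)) (cong (b ℤ.^_) (sym (ℕP.^-distribˡ-+-* p (s ∸ k ∸ 1) k)))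
... | false = k , refl

-1^n≡±1 : ∀ n → -[1+ 0 ] ℤ.^ n ≡ + 1 ⊎ -[1+ 0 ] ℤ.^ n ≡ -[1+ 0 ]
-1^n≡±1 zero    = inj₁ refl
-1^n≡±1 (suc n) with -1^n≡±1 n
... | inj₁ eq = inj₂ (cong (ℤ._*_ -[1+ 0 ]) eq)
... | inj₂ eq = inj₁ (cong (ℤ._*_ -[1+ 0 ]) eq)

-- For a = ±1 the number a^(p-1) - 1 is 0 or -2, whose valuation is infinite or at most 1.
∣a∣≡1⇒¬ValEq : ∀ {p r} a → 1 < p → 1 ≤ r → ℤ.∣ a ∣ ≡ 1 → ¬ ValEq p (a ℤ.^ (p ∸ 1) ℤ.- + 1) (suc r)
∣a∣≡1⇒¬ValEq {p} {r} (+ 1) _ _ _ (_ , ¬p^[2+r]∣) =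
  ¬p^[2+r]∣ (subst (λ x → + (p ^ suc (suc r)) ℤD.∣ (x ℤ.- + 1)) (sym (ℤP.^-zeroˡ (p ∸ 1))) (_ ∣0))
∣a∣≡1⇒¬ValEq {p} {r} -[1+ 0 ] 1<p 1≤r _ (p^[1+r]∣ , ¬p^[2+r]∣) with -1^n≡±1 (p ∸ 1)
... | inj₁ eq = ¬p^[2+r]∣ (subst (λ x → + (p ^ suc (suc r)) ℤD.∣ (x ℤ.- + 1)) (sym eq) (_ ∣0))
... | inj₂ eq with ℕP.≤-trans (ℕP.*-mono-≤ 1<p (ℕP.≤-trans 1<p p≤p^r))
                   (∣⇒≤ (subst (λ x → + (p ^ suc r) ℤD.∣ (x ℤ.- + 1)) eq p^[1+r]∣))
  where
  instance _ = ℕ.>-nonZero (ℕP.<-trans (s≤s z≤n) 1<p)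
  p≤p^r : p ≤ p ^ r
  p≤p^r = subst (_≤ p ^ r) (ℕP.*-identityʳ p) (ℕP.^-monoʳ-≤ p 1≤r)
...   | s≤s (s≤s ())

x*a≡1⇒∣a∣≡1 : ∀ x a → x ℤ.* a ≡ + 1 → ℤ.∣ a ∣ ≡ 1
x*a≡1⇒∣a∣≡1 x a xa≡1 = ℕP.m*n≡1⇒n≡1 ℤ.∣ x ∣ ℤ.∣ a ∣ (trans (sym (ℤP.abs-* x a)) (cong ℤ.∣_∣ xa≡1))

a′^p^k≡b′^[1+[p-1]h] : ∀ b′ p s k .{{_ : ℕ.NonZero p}} → ∃ λ h → a′ b′ p s k ℤ.^ (p ^ k) ≡ b′ ℤ.^ suc ((p ∸ 1) * h)
a′^p^k≡b′^[1+[p-1]h] b′ p s k with a′^p^k≡b′^p^u b′ p s k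
... | u , a′^p^k≡b′^p^u with [1+x]^n≡1+x*h (p ∸ 1) u
...   | h , p^u≡1+[p-1]h =
  h , trans a′^p^k≡b′^p^u (cong (b′ ℤ.^_) (trans (cong (_^ u) (sym (ℕP.suc-pred p))) p^u≡1+[p-1]h))

a′^p^k*a≡1 : ∀ {p} → Prime p → ∀ a b′ s k r → k ≤ r
  → (+ (p ^ suc r)) ℤD.∣ (a ℤ.^ (p ∸ 1) ℤ.- + 1) → (+ (p ^ suc k)) ℤD.∣ (a ℤ.* b′ ℤ.- + 1)
  → (+ (p ^ suc k)) ℤS.∣ (a′ b′ p s k ℤ.^ (p ^ k) ℤ.* a ℤ.- + 1)
a′^p^k*a≡1 {p} pp a b′ s k r k≤r p^[1+r]∣a^[p-1]-1 p^[1+k]∣ab′-1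
  with a′^p^k≡b′^[1+[p-1]h] b′ p s k {{prime⇒nonZero pp}}
... | h , a′^p^k≡ = subst (λ x → (+ (p ^ suc k)) ℤS.∣ (x ℤ.* a ℤ.- + 1)) (sym a′^p^k≡)
  (b^[1+th]*a≡1 a b′ (p ∸ 1) h (ℤS.∣ᵤ⇒∣ p^[1+k]∣ab′-1) (ℤS.∣ᵤ⇒∣ (∣-trans (^-monoʳ-∣ p (s≤s k≤r)) p^[1+r]∣a^[p-1]-1)))

a′^p^k*a≢1 : ∀ {p} → Prime p → ∀ a b′ s k r → 1 ≤ r
  → ValEq p (a ℤ.^ (p ∸ 1) ℤ.- + 1) (suc r) → a′ b′ p s k ℤ.^ (p ^ k) ℤ.* a ≢ + 1
a′^p^k*a≢1 {p} pp a b′ s k r 1≤r val c≡1 with a′^p^k≡b′^[1+[p-1]h] b′ p s k {{prime⇒nonZero pp}}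
... | h , a′^p^k≡ = ∣a∣≡1⇒¬ValEq a (nonTrivial⇒n>1 p {{prime⇒nonTrivial pp}}) 1≤r
  (x*a≡1⇒∣a∣≡1 (b′ ℤ.^ suc ((p ∸ 1) * h)) a (trans (cong (ℤ._* a) (sym a′^p^k≡)) c≡1)) val

∣c-1⇒c≡1+q*p*z : ∀ p q c → (+ (p * q)) ℤS.∣ (c ℤ.- + 1) → c ≢ + 1 → ∃ λ z → z ≢ + 0 × c ≡ + 1 ℤ.+ + q ℤ.* (+ p ℤ.* z)
∣c-1⇒c≡1+q*p*z p q c (ℤS.divides z c-1≡z[pq]) c≢1 = z , z≢0 , c≡1+q[pz]
  where
  c≡1+q[pz] : c ≡ + 1 ℤ.+ + q ℤ.* (+ p ℤ.* z)
  c≡1+q[pz] = begin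
      c                                ≡⟨ solve 1 (λ c → c := con (+ 1) :+ (c :- con (+ 1))) refl c ⟩
      + 1 ℤ.+ (c ℤ.- + 1)              ≡⟨ cong (ℤ._+_ (+ 1)) (trans c-1≡z[pq] (cong (ℤ._*_ z) (ℤP.pos-* p q))) ⟩
      + 1 ℤ.+ z ℤ.* (+ p ℤ.* + q)      ≡⟨ solve 3 (λ z p q → con (+ 1) :+ z :* (p :* q) := con (+ 1) :+ q :* (p :* z)) refl z (+ p) (+ q) ⟩
      + 1 ℤ.+ + q ℤ.* (+ p ℤ.* z)      ∎
    where
    open ≡-Reasoning
    open ℤ-Solver
  z≢0 : z ≢ + 0
  z≢0 refl = c≢1 (trans c≡1+q[pz] (cong (ℤ._+_ (+ 1)) (trans (cong (ℤ._*_ (+ q)) (ℤP.*-zeroʳ (+ p))) (ℤP.*-zeroʳ (+ q)))))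

p^k*p*z∣binomialCoeff : ∀ {p} → Prime p → ∀ k z j → j < p ^ k
  → (+ (p ^ k) ℤ.* (+ p ℤ.* z)) ℤS.∣ binomialCoeff (+ p ℤ.* z) (p ^ k) j
p^k*p*z∣binomialCoeff {p} pp k z j j<q = ℤS.divides (+ t ℤ.* z ℤ.^ r) (begin
    + (q C j) ℤ.* d ℤ.^ (q ∸ j)                        ≡⟨ cong (λ e → + (q C j) ℤ.* d ℤ.^ e) (ℕP.+-∸-assoc 1 j<q) ⟩
    + (q C j) ℤ.* (d ℤ.* d ℤ.^ r)                      ≡⟨ cong (λ x → + (q C j) ℤ.* (d ℤ.* x)) d^r≡p^r*z^r ⟩
    + (q C j) ℤ.* (d ℤ.* (+ (p ^ r) ℤ.* z ℤ.^ r))      ≡⟨ solve 4 (λ c d x y → c :* (d :* (x :* y)) := c :* x :* y :* d) refl (+ (q C j)) d (+ (p ^ r)) (z ℤ.^ r) ⟩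
    + (q C j) ℤ.* + (p ^ r) ℤ.* z ℤ.^ r ℤ.* d          ≡⟨ cong (λ x → x ℤ.* z ℤ.^ r ℤ.* d) (trans (sym (ℤP.pos-* (q C j) (p ^ r))) (trans (cong +_ equality) (ℤP.pos-* t q))) ⟩
    + t ℤ.* + q ℤ.* z ℤ.^ r ℤ.* d                      ≡⟨ solve 4 (λ t q y d → t :* q :* y :* d := t :* y :* (q :* d)) refl (+ t) (+ q) (z ℤ.^ r) d ⟩
    + t ℤ.* z ℤ.^ r ℤ.* (+ q ℤ.* d)                    ∎)
  where
  open ≡-Reasoning; open ℤ-Solver
  q = p ^ k
  r = q ∸ suc j
  d = + p ℤ.* z
  open _∣_ (p^k∣[p^k]Cj*p^[p^k∸1+j] pp k j j<q) renaming (quotient to t)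
  d^r≡p^r*z^r : d ℤ.^ r ≡ + (p ^ r) ℤ.* z ℤ.^ r
  d^r≡p^r*z^r = trans (^-distribʳ-* (+ p) z r) (cong (ℤ._* z ℤ.^ r) (sym (pos-^ p r)))

lemma1p1 : (n : ℕ) (a : ℤ) → 2 ≤ n → IrreducibleQ (binomial n a)
    → (p : ℕ) → Prime p → p ∣ n
    → (s : ℕ) → 1 ≤ s → ValEqℕ p n s
    → ¬ ((+ p) ℤD.∣ a)
    → (r : ℕ) → ValEq p ((a ℤ.^ (p ∸ 1)) ℤ.- + 1) (suc r) → 1 ≤ r
    → (k : ℕ) → 1 ≤ k → k ≤ r → k ≤ s
    → (b′ : ℤ) → (+ (p ^ suc k)) ℤD.∣ ((a ℤ.* b′) ℤ.- + 1)
    → (n′ : ℕ) → n ≡ n′ * p ^ k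
    → IsAlgIntegerIn n a (scaleₚ (invℕ (p ^ k)) (η (a′ b′ p s k) n′ (p ^ k)))
lemma1p1 n a _ _ p pp _ s _ _ _ r val 1≤r k _ k≤r _ b′ p^[k+1]∣ab′-1 n′ n≡n′p^k =
  isIntegral⇒isAlgInteger (meanOfPowers-isIntegral γ d (p ^ k) qd≢0 (p^k*p*z∣binomialCoeff pp k z) γ^q≈1+qd)
  where
  open RadicalExtension n a
  open Modulo (binomial n a)
  c = a′ b′ p s k ℤ.^ (p ^ k) ℤ.* a
  c≡1+qpz : ∃ λ z → z ≢ + 0 × c ≡ + 1 ℤ.+ + (p ^ k) ℤ.* (+ p ℤ.* z)
  c≡1+qpz = ∣c-1⇒c≡1+q*p*z p (p ^ k) c
    (a′^p^k*a≡1 pp a b′ s k r k≤r (proj₁ val) p^[k+1]∣ab′-1) (a′^p^k*a≢1 pp a b′ s k r 1≤r val)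
  z = proj₁ c≡1+qpz
  d = + p ℤ.* z
  γ = scaleₚ (ℤtoℚ (a′ b′ p s k)) (xpow n′)
  instance
    _ = prime⇒nonZero pp
    _ = ℕP.m^n≢0 p k
    _ = ℤ.≢-nonZero (proj₁ (proj₂ c≡1+qpz))
  qd≢0 : + (p ^ k) ℤ.* d ≢ + 0
  qd≢0 = ℕ.≢-nonZero⁻¹ ℤ.∣ + (p ^ k) ℤ.* d ∣ {{ℤP.i*j≢0 (+ (p ^ k)) d {{ℕP.m^n≢0 p k}} {{ℤP.i*j≢0 (+ p) z}}}} ∘ cong ℤ.∣_∣
  γ^q≈1+qd : γ ^ₘ (p ^ k) ≈ₘ 1ₚ +ₚ fromℤ (+ (p ^ k) ℤ.* d)
  γ^q≈1+qd = ≈ₘ-trans (monomial-^ (a′ b′ p s k) n′ (p ^ k) n≡n′p^k)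
    (≈ₘ-trans (≋⇒≈ₘ (≡⇒≋ (cong fromℤ (proj₂ (proj₂ c≡1+qpz))))) (fromℤ-+ (+ 1) (+ (p ^ k) ℤ.* d)))
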